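{- Let $T$ be a tournament admitting a transitive component $C$ that is a nontrivial module of $T$. Then there exists $M \in {\rm mc}(T)$ such that $M \cap C = \emptyset$ and $o_T(M) \leq 1$.
   Context: A tournament $T$ is a finite vertex set $V(T)$ with an arc set $A(T)$ such that for all distinct $x,y$, exactly one of $(x,y),(y,x)$ lies in $A(T)$; it is transitive if $(x,y),(y,z)\in A(T)$ imply $(x,z)\in A(T)$. A module of $T$ is a subset $M$ such that for all $x,y \in M$ and $v \notin M$, $(v,x)\in A(T)$ iff $(v,y)\in A(T)$; trivial modules are $\emptyset$, singletons and $V(T)$. A transitive component is a module $C$ with $T[C]$ transitive, maximal under inclusion among such modules. With $\overline{X} = V(T)\setminus X$, a co-module is a set $M$ such that $M$ or $\overline{M}$ is a nontrivial module; a minimal co-module is one containing no other co-module; ${\rm mc}(T)$ is the set of these. Two sets overlap if their intersection and both differences are nonempty. For $M\in{\rm mc}(T)$, $o_T(M)$ is the number of $N\in{\rm mc}(T)$ overlapping $M$. -}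

module Defs where

open import Data.Nat using (ℕ)
open import Data.Fin using (Fin)
open import Data.Bool using (Bool; true; false; not)
open import Data.Fin.Subset public
  using (Subset; _∈_; _∉_; _⊆_; ∁; _∩_; _─_; ⁅_⁆; Nonempty; Empty)
import Data.Fin.Subset as S
open import Data.Product using (Σ; ∃; _×_)
open import Data.Sum using (_⊎_)
open import Relation.Nullary using (¬_)
open import Relation.Binary.PropositionalEquality using (_≡_; _≢_)

-- A tournament on vertex set Fin n; arc x y ≡ true means (x , y) ∈ A(T).
record Tournament (n : ℕ) : Set where
  field
    arc     : Fin n → Fin n → Bool
    irrefl  : ∀ x → arc x x ≡ false
    exactly : ∀ x y → x ≢ y → arc x y ≡ not (arc y x)
open Tournament public

module _ {n : ℕ} (T : Tournament n) where

  IsModule : Subset n → Set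
  IsModule M = ∀ x y v → x ∈ M → y ∈ M → v ∉ M → arc T v x ≡ arc T v y

  Trivial : Subset n → Set
  Trivial M = (M ≡ S.⊥) ⊎ ((∃ λ x → M ≡ ⁅ x ⁆) ⊎ (M ≡ S.⊤))

  NontrivialModule : Subset n → Set
  NontrivialModule M = IsModule M × ¬ Trivial M

  TransitiveOn : Subset n → Set
  TransitiveOn C = ∀ x y z → x ∈ C → y ∈ C → z ∈ C →
                   arc T x y ≡ true → arc T y z ≡ true → arc T x z ≡ true

  TransitiveComponent : Subset n → Set
  TransitiveComponent C =
    IsModule C × TransitiveOn C ×
    (∀ D → IsModule D → TransitiveOn D → C ⊆ D → D ≡ C)

  CoModule : Subset n → Set
  CoModule M = NontrivialModule M ⊎ NontrivialModule (∁ M)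

  MinCoModule : Subset n → Set
  MinCoModule M = CoModule M × (∀ N → CoModule N → N ⊆ M → N ≡ M)

  Overlap : Subset n → Subset n → Set
  Overlap M N = Nonempty (M ∩ N) × Nonempty (M ─ N) × Nonempty (N ─ M)

  AtMostOneOverlap : Subset n → Set
  AtMostOneOverlap M = ∀ N N′ → MinCoModule N → MinCoModule N′ →
                       Overlap M N → Overlap M N′ → N ≡ N′

-- Let M be a minimal co-module inside the complement of C. If the complement of M is a
-- module, then M overlaps no co-module at all. If M is a module, any minimal co-module N
-- overlapping M forces M = {p, q} and N = {p, r}; when no vertex outside M is a twin of a
-- vertex of M with an out-neighbour in M, the arcs must run q → p → r, and then p is fixed
-- by M and r is the unique out-neighbour of p that is its twin, so o(M) ≤ 1. Otherwise such
-- a twin w → x yields either the minimal co-module {w} or the minimal co-module {w, x},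
-- which avoids C because a maximal transitive module is closed under twins. Repeating with
-- {w, x}, the out-neighbourhood of the source of the pair's arc strictly grows, so this ends.

module Submission where

open import Defs
open import Data.Nat using (ℕ)
open import Data.Fin using (Fin) renaming (_≟_ to _≟ᶠ_)
open import Data.Fin.Properties using (all?; any?)
open import Data.Bool using (Bool; true; false; not)
open import Data.Bool.Properties using () renaming (_≟_ to _≟ᵇ_)
open import Data.Vec using (_∷_; tabulate; here; there)
open import Data.Vec.Properties using (≡-dec; lookup∘tabulate; []=⇒lookup; lookup⇒[]=)
open import Data.Fin.Subset using (_⊂_; _⊃_; _∪_)
import Data.Fin.Subset as S
open import Data.Fin.Subset.Properties
open import Data.Fin.Subset.Induction using (Acc; acc; ⊂-wellFounded; ⊃-wellFounded)
open import Data.Product using (∃; ∃-syntax; _×_; _,_; proj₁; proj₂; swap)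
open import Data.Sum using (_⊎_; inj₁; inj₂; [_,_]′)
import Data.Sum as Sum
open import Data.Empty using (⊥-elim)
open import Function.Base using (_on_; _∘′_)
open import Relation.Nullary using (Dec; yes; no; ¬_)
open import Relation.Nullary.Decidable using (_×-dec_; _⊎-dec_; _→-dec_; ¬?; decidable-stable; toSum)
open import Relation.Unary using (Decidable)
import Relation.Binary.Construct.On as On
open import Relation.Binary.PropositionalEquality

private
  variable
    n : ℕ

_≟ₛ_ : (p q : Subset n) → Dec (p ≡ q)
_≟ₛ_ = ≡-dec _≟ᵇ_

∈-stable : ∀ {x : Fin n} {p} → ¬ x ∉ p → x ∈ p
∈-stable {x = x} {p} = decidable-stable (x ∈? p)

x∈p─q⇒x∉q : ∀ {p q : Subset n} {x} → x ∈ p ─ q → x ∉ q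
x∈p─q⇒x∉q {p = _ ∷ _} {false ∷ _} here ()
x∈p─q⇒x∉q {p = _ ∷ _} {_ ∷ _} (there x∈) (there x∈q) = x∈p─q⇒x∉q x∈ x∈q

∁-involutive : (p : Subset n) → ∁ (∁ p) ≡ p
∁-involutive p = ⊆-antisym (λ x∈ → x∉∁p⇒x∈p (x∈∁p⇒x∉p x∈)) (λ x∈ → x∉p⇒x∈∁p (x∈p⇒x∉∁p x∈))

⊆∧≢⇒⊂ : ∀ {p q : Subset n} → p ⊆ q → p ≢ q → p ⊂ q
⊆∧≢⇒⊂ {p = p} {q} p⊆q p≢q with any? (λ x → (x ∈? q) ×-dec ¬? (x ∈? p))
... | yes witness = p⊆q , witness
... | no none = ⊥-elim (p≢q (⊆-antisym p⊆q (λ {x} x∈q → ∈-stable (λ x∉p → none (x , x∈q , x∉p)))))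

Empty-∩⁺ : ∀ {p q : Subset n} → (∀ {x} → x ∈ p → x ∉ q) → Empty (p ∩ q)
Empty-∩⁺ {p = p} {q} disj (x , x∈) = let x∈p , x∈q = x∈p∩q⁻ p q x∈ in disj x∈p x∈q

Empty-∩⁻ : ∀ {p q : Subset n} {x} → Empty (p ∩ q) → x ∈ p → x ∉ q
Empty-∩⁻ empty x∈p x∈q = empty (_ , x∈p∩q⁺ (x∈p , x∈q))

pair : Fin n → Fin n → Subset n
pair x y = ⁅ x ⁆ ∪ ⁅ y ⁆

∈-pairˡ : (x y : Fin n) → x ∈ pair x y
∈-pairˡ x y = x∈p∪q⁺ (inj₁ (x∈⁅x⁆ x))

∈-pairʳ : (x y : Fin n) → y ∈ pair x y
∈-pairʳ x y = x∈p∪q⁺ (inj₂ (x∈⁅x⁆ y))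

∈-pair⁻ : ∀ {x y z : Fin n} → z ∈ pair x y → z ≡ x ⊎ z ≡ y
∈-pair⁻ {x = x} {y} z∈ with x∈p∪q⁻ ⁅ x ⁆ ⁅ y ⁆ z∈
... | inj₁ z∈x = inj₁ (x∈⁅y⁆⇒x≡y x z∈x)
... | inj₂ z∈y = inj₂ (x∈⁅y⁆⇒x≡y y z∈y)

∉-pair⁺ : ∀ {x y z : Fin n} → z ≢ x → z ≢ y → z ∉ pair x y
∉-pair⁺ z≢x z≢y z∈ = [ z≢x , z≢y ]′ (∈-pair⁻ z∈)

pair-⊆ : ∀ {x y : Fin n} {p} → x ∈ p → y ∈ p → pair x y ⊆ p
pair-⊆ x∈ y∈ z∈ = [ (λ { refl → x∈ }) , (λ { refl → y∈ }) ]′ (∈-pair⁻ z∈)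

⊆-pair⁻ : ∀ {x y : Fin n} {p} → p ⊆ pair x y →
          pair x y ⊆ p ⊎ p ⊆ ⁅ x ⁆ ⊎ p ⊆ ⁅ y ⁆
⊆-pair⁻ {x = x} {y} {p} p⊆ with x ∈? p | y ∈? p
... | yes x∈ | yes y∈ = inj₁ (pair-⊆ x∈ y∈)
... | yes _  | no y∉ = inj₂ (inj₁ λ z∈ →
  [ (λ { refl → x∈⁅x⁆ x }) , (λ { refl → ⊥-elim (y∉ z∈) }) ]′ (∈-pair⁻ (p⊆ z∈)))
... | no x∉  | _ = inj₂ (inj₂ λ z∈ →
  [ (λ { refl → ⊥-elim (x∉ z∈) }) , (λ { refl → x∈⁅x⁆ y }) ]′ (∈-pair⁻ (p⊆ z∈)))

∈-∪-⁅⁆⁻ : ∀ {p : Subset n} {x u} → u ∈ p ∪ ⁅ x ⁆ → u ∈ p ⊎ u ≡ x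
∈-∪-⁅⁆⁻ {p = p} {x} u∈ with x∈p∪q⁻ p ⁅ x ⁆ u∈
... | inj₁ u∈p = inj₁ u∈p
... | inj₂ u∈x = inj₂ (x∈⁅y⁆⇒x≡y x u∈x)

module _ {P : Subset n → Set} where

  Minimal : Subset n → Set
  Minimal M = P M × (∀ N → P N → N ⊆ M → N ≡ M)

  minimal-⊆ : Decidable P → ∀ {M} → P M → ∃ λ N → Minimal N × N ⊆ M
  minimal-⊆ P? {M} = go M (⊂-wellFounded M)
    where
    go : ∀ M → Acc _⊂_ M → P M → ∃ λ N → Minimal N × N ⊆ M
    go M (acc rs) pM with anySubset? (λ K → P? K ×-dec (K ⊆? M) ×-dec ¬? (K ≟ₛ M))
    ... | yes (K , pK , K⊆M , K≢M) =
      let N , minN , N⊆K = go K (rs (⊆∧≢⇒⊂ K⊆M K≢M)) pK in N , minN , ⊆-trans N⊆K K⊆M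
    ... | no none =
      M , (pM , λ K pK K⊆M → decidable-stable (K ≟ₛ M) (λ K≢M → none (K , pK , K⊆M , K≢M))) , ⊆-refl

module _ (T : Tournament n) where

  private
    A : Fin n → Fin n → Bool
    A = arc T

  arc-flip : ∀ {x y} → x ≢ y → A x y ≡ not (A y x)
  arc-flip {x} {y} = exactly T x y

  arc-irrefl : ∀ {x} → A x x ≢ true
  arc-irrefl {x} x→x with trans (sym (irrefl T x)) x→x
  ... | ()

  arc-asym : ∀ {x y} → A x y ≡ true → A y x ≢ true
  arc-asym {x} {y} x→y y→x with x ≟ᶠ y
  ... | yes refl = arc-irrefl x→y
  ... | no x≢y with trans (sym x→y) (trans (arc-flip x≢y) (cong not y→x))
  ...   | ()

  arc-reverse : ∀ {x y} → x ≢ y → A x y ≡ false → A y x ≡ true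
  arc-reverse x≢y x↛y = trans (arc-flip (x≢y ∘′ sym)) (cong not x↛y)

  arc-reverse′ : ∀ {x y} → x ≢ y → A x y ≡ true → A y x ≡ false
  arc-reverse′ x≢y x→y = trans (arc-flip (x≢y ∘′ sym)) (cong not x→y)

  Twins : Fin n → Fin n → Set
  Twins x y = IsModule T (pair x y)

  isModule? : Decidable (IsModule T)
  isModule? M = all? λ x → all? λ y → all? λ v →
    (x ∈? M) →-dec (y ∈? M) →-dec ¬? (v ∈? M) →-dec (A v x ≟ᵇ A v y)

  trivial? : Decidable (Trivial T)
  trivial? M = (M ≟ₛ S.⊥) ⊎-dec (any? (λ x → M ≟ₛ ⁅ x ⁆)) ⊎-dec (M ≟ₛ S.⊤)

  nontrivialModule? : Decidable (NontrivialModule T)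
  nontrivialModule? M = isModule? M ×-dec ¬? (trivial? M)

  coModule? : Decidable (CoModule T)
  coModule? M = nontrivialModule? M ⊎-dec nontrivialModule? (∁ M)

  nontrivial⁺ : ∀ {S a b c} → a ∈ S → b ∈ S → a ≢ b → c ∉ S → ¬ Trivial T S
  nontrivial⁺ a∈ b∈ a≢b c∉ (inj₁ refl) = ∉⊥ a∈
  nontrivial⁺ a∈ b∈ a≢b c∉ (inj₂ (inj₁ (z , refl))) =
    a≢b (trans (x∈⁅y⁆⇒x≡y z a∈) (sym (x∈⁅y⁆⇒x≡y z b∈)))
  nontrivial⁺ a∈ b∈ a≢b c∉ (inj₂ (inj₂ refl)) = c∉ ∈⊤

  nontrivial⁻ : ∀ {S} → ¬ Trivial T S →
                ∃[ a ] ∃[ b ] ∃[ c ] (a ∈ S × b ∈ S × a ≢ b × c ∉ S)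
  nontrivial⁻ {S} nontrivial with nonempty? S
  ... | no empty = ⊥-elim (nontrivial (inj₁ (Empty-unique empty)))
  ... | yes (a , a∈) with any? (λ b → (b ∈? S) ×-dec ¬? (a ≟ᶠ b))
  ...   | no none = ⊥-elim (nontrivial (inj₂ (inj₁ (a , ⊆-antisym S⊆a a⊆S))))
    where
    S⊆a : S ⊆ ⁅ a ⁆
    S⊆a {b} b∈ with a ≟ᶠ b
    ... | yes refl = x∈⁅x⁆ a
    ... | no a≢b = ⊥-elim (none (b , b∈ , a≢b))
    a⊆S : ⁅ a ⁆ ⊆ S
    a⊆S b∈ rewrite x∈⁅y⁆⇒x≡y a b∈ = a∈
  ...   | yes (b , b∈ , a≢b) with any? (λ c → ¬? (c ∈? S))
  ...     | yes (c , c∉) = a , b , c , a∈ , b∈ , a≢b , c∉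
  ...     | no none =
    ⊥-elim (nontrivial (inj₂ (inj₂ (⊆-antisym ⊆⊤ λ {c} _ → ∈-stable (λ c∉ → none (c , c∉))))))

  coModule-nonempty : ∀ {M} → CoModule T M → Nonempty M
  coModule-nonempty (inj₁ (_ , nontrivial)) =
    let a , _ , _ , a∈ , _ = nontrivial⁻ nontrivial in a , a∈
  coModule-nonempty (inj₂ (_ , nontrivial)) =
    let _ , _ , c , _ , _ , _ , c∉ = nontrivial⁻ nontrivial in c , x∉∁p⇒x∈p c∉

  ∁-coModule : ∀ {M} → NontrivialModule T M → CoModule T (∁ M)
  ∁-coModule {M} = inj₂ ∘′ subst (NontrivialModule T) (sym (∁-involutive M))

  private
    ∈∉⇒≢ : ∀ {x y} {P : Subset n} → x ∈ P → y ∉ P → x ≢ y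
    ∈∉⇒≢ x∈ y∉ refl = y∉ x∈

  module-outArc : ∀ {M x y v} → IsModule T M → x ∈ M → y ∈ M → v ∉ M → A x v ≡ A y v
  module-outArc {M} {x} {y} {v} M-mod x∈ y∈ v∉ = begin
    A x v        ≡⟨ arc-flip (∈∉⇒≢ x∈ v∉) ⟩
    not (A v x)  ≡⟨ cong not (M-mod x y v x∈ y∈ v∉) ⟩
    not (A v y)  ≡⟨ arc-flip (∈∉⇒≢ y∈ v∉) ⟨
    A y v        ∎
    where open ≡-Reasoning

  module-∩ : ∀ {P Q} → IsModule T P → IsModule T Q → IsModule T (P ∩ Q)
  module-∩ {P} {Q} P-mod Q-mod x y v x∈ y∈ v∉ with x∈p∩q⁻ P Q x∈ | x∈p∩q⁻ P Q y∈ | v ∈? P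
  ... | x∈P , _ | y∈P , _ | no v∉P = P-mod x y v x∈P y∈P v∉P
  ... | _ , x∈Q | _ , y∈Q | yes v∈P = Q-mod x y v x∈Q y∈Q (λ v∈Q → v∉ (x∈p∩q⁺ (v∈P , v∈Q)))

  module-∪ : ∀ {P Q t} → IsModule T P → IsModule T Q → t ∈ P → t ∈ Q → IsModule T (P ∪ Q)
  module-∪ {P} {Q} {t} P-mod Q-mod t∈P t∈Q x y v x∈ y∈ v∉ = trans (toCommon x∈) (sym (toCommon y∈))
    where
    toCommon : ∀ {u} → u ∈ P ∪ Q → A v u ≡ A v t
    toCommon {u} u∈ with x∈p∪q⁻ P Q u∈
    ... | inj₁ u∈P = P-mod u t v u∈P t∈P (v∉ ∘′ p⊆p∪q Q)
    ... | inj₂ u∈Q = Q-mod u t v u∈Q t∈Q (v∉ ∘′ q⊆p∪q P Q)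

  module-─ : ∀ {P Q s} → IsModule T P → IsModule T Q → s ∈ Q → s ∉ P → IsModule T (P ─ Q)
  module-─ {P} {Q} {s} P-mod Q-mod s∈Q s∉P x y v x∈ y∈ v∉ with v ∈? P
  ... | no v∉P = P-mod x y v (p─q⊆p P Q x∈) (p─q⊆p P Q y∈) v∉P
  ... | yes v∈P = trans (viaS x∈) (sym (viaS y∈))
    where
    v∈Q : v ∈ Q
    v∈Q = ∈-stable (v∉ ∘′ x∈p∧x∉q⇒x∈p─q v∈P)
    -- u ∉ Q sees v, s ∈ Q alike, and s ∉ P sees u, y ∈ P alike.
    viaS : ∀ {u} → u ∈ P ─ Q → A v u ≡ A s y
    viaS {u} u∈ = trans (module-outArc Q-mod v∈Q s∈Q (x∈p─q⇒x∉q u∈))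
                        (P-mod u y s (p─q⊆p P Q u∈) (p─q⊆p P Q y∈) s∉P)

  minCoModule-submodule-subsingleton :
    ∀ {M S a b c} → MinCoModule T M → IsModule T S → S ⊆ M → c ∈ M → c ∉ S →
    a ∈ S → b ∈ S → a ≡ b
  minCoModule-submodule-subsingleton {M} {S} {a} {b} (_ , minimal) S-mod S⊆M c∈M c∉S a∈ b∈
    with a ≟ᶠ b
  ... | yes a≡b = a≡b
  ... | no a≢b = ⊥-elim (c∉S (subst (_ ∈_) (sym S≡M) c∈M))
    where
    S≡M : S ≡ M
    S≡M = minimal S (inj₁ (S-mod , nontrivial⁺ a∈ b∈ a≢b c∉S)) S⊆M

  module⊇∁-avoids : ∀ {M S x y} → MinCoModule T M → NontrivialModule T (∁ M) →
                    IsModule T S → ∁ M ⊆ S → x ∈ M → x ∉ S → y ∈ M → y ∉ S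
  module⊇∁-avoids {M} {S} (_ , minimal) (_ , ∁M-nontrivial) S-mod ∁M⊆S x∈M x∉S y∈M =
    x∈∁p⇒x∉p (subst (_ ∈_) (sym ∁S≡M) y∈M)
    where
    ∁S≡M : ∁ S ≡ M
    ∁S≡M with nontrivial⁻ ∁M-nontrivial
    ... | _ , _ , _ , a∈ , b∈ , a≢b , _ =
      minimal (∁ S) (∁-coModule (S-mod , nontrivial⁺ (∁M⊆S a∈) (∁M⊆S b∈) a≢b x∉S))
                    (λ z∈∁S → x∉∁p⇒x∈p (x∈∁p⇒x∉p z∈∁S ∘′ ∁M⊆S))

  overlap⁻ : ∀ {M N} → Overlap T M N →
             ∃[ p ] ∃[ q ] ∃[ r ] (p ∈ M × p ∈ N × q ∈ M × q ∉ N × r ∈ N × r ∉ M)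
  overlap⁻ {M} {N} ((p , p∈) , (q , q∈) , (r , r∈)) =
    p , q , r , proj₁ (x∈p∩q⁻ M N p∈) , proj₂ (x∈p∩q⁻ M N p∈) ,
    p─q⊆p M N q∈ , x∈p─q⇒x∉q q∈ , p─q⊆p N M r∈ , x∈p─q⇒x∉q r∈

  overlap-sym : ∀ {M N} → Overlap T M N → Overlap T N M
  overlap-sym {M} {N} ((p , p∈) , M─N , N─M) = (p , x∈p∩q⁺ (swap (x∈p∩q⁻ M N p∈))) , N─M , M─N

  -- ∁M ∪ N, or ∁M ∪ ∁N when these meet, is a module containing ∁M that splits M; otherwise ∁N ⊆ M.
  ∁-module-overlap-free : ∀ {M N} → MinCoModule T M → NontrivialModule T (∁ M) →
                          CoModule T N → ¬ Overlap T M N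
  ∁-module-overlap-free {M} {N} M-min ∁M-ntm@(∁M-mod , _) N-co M⋈N with overlap⁻ M⋈N | N-co
  ... | _ , _ , _ , p∈M , p∈N , q∈M , q∉N , r∈N , r∉M | inj₁ (N-mod , _) =
    module⊇∁-avoids M-min ∁M-ntm (module-∪ ∁M-mod N-mod (x∉p⇒x∈∁p r∉M) r∈N) (p⊆p∪q N)
      q∈M (λ q∈ → [ x∈p⇒x∉∁p q∈M , q∉N ]′ (x∈p∪q⁻ (∁ M) N q∈)) p∈M (q⊆p∪q (∁ M) N p∈N)
  ... | _ , _ , _ , p∈M , p∈N , q∈M , q∉N , _ | inj₂ ∁N-ntm@(∁N-mod , _)
    with any? (λ t → (t ∈? ∁ M) ×-dec (t ∈? ∁ N))
  ...   | yes (_ , t∈∁M , t∈∁N) =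
    module⊇∁-avoids M-min ∁M-ntm (module-∪ ∁M-mod ∁N-mod t∈∁M t∈∁N) (p⊆p∪q (∁ N))
      p∈M (λ p∈ → [ x∈p⇒x∉∁p p∈M , x∈p⇒x∉∁p p∈N ]′ (x∈p∪q⁻ (∁ M) (∁ N) p∈))
      q∈M (q⊆p∪q (∁ M) (∁ N) (x∉p⇒x∈∁p q∉N))
  ...   | no none = x∈∁p⇒x∉p (subst (_ ∈_) (sym ∁N≡M) p∈M) p∈N
    where
    ∁N≡M : ∁ N ≡ M
    ∁N≡M = proj₂ M-min (∁ N) (inj₁ ∁N-ntm)
             (λ z∈∁N → ∈-stable (λ z∉M → none (_ , x∉p⇒x∈∁p z∉M , z∈∁N)))

  overlapping-modules-pair : ∀ {M N p q r} → MinCoModule T M → IsModule T M → IsModule T N →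
                             p ∈ M → p ∈ N → q ∈ M → q ∉ N → r ∈ N → r ∉ M → M ≡ pair p q
  overlapping-modules-pair {M} {N} {p} {q} {r} M-min M-mod N-mod p∈M p∈N q∈M q∉N r∈N r∉M =
    ⊆-antisym M⊆pq (pair-⊆ p∈M q∈M)
    where
    M⊆pq : M ⊆ pair p q
    M⊆pq {u} u∈M with u ∈? N
    ... | yes u∈N = subst (_∈ pair p q) (sym u≡p) (∈-pairˡ p q)
      where
      u≡p : u ≡ p
      u≡p = minCoModule-submodule-subsingleton M-min (module-∩ M-mod N-mod) (p∩q⊆p M N) q∈M
              (q∉N ∘′ proj₂ ∘′ x∈p∩q⁻ M N) (x∈p∩q⁺ (u∈M , u∈N)) (x∈p∩q⁺ (p∈M , p∈N))
    ... | no u∉N = subst (_∈ pair p q) (sym u≡q) (∈-pairʳ p q)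
      where
      u≡q : u ≡ q
      u≡q = minCoModule-submodule-subsingleton M-min (module-─ M-mod N-mod r∈N r∉M) (p─q⊆p M N) p∈M
              (λ p∈ → x∈p─q⇒x∉q p∈ p∈N) (x∈p∧x∉q⇒x∈p─q u∈M u∉N) (x∈p∧x∉q⇒x∈p─q q∈M q∉N)

  overlap-shape : ∀ {M N} → MinCoModule T M → IsModule T M → MinCoModule T N → Overlap T M N →
                  ∃[ p ] ∃[ q ] ∃[ r ]
                    (M ≡ pair p q × N ≡ pair p r × IsModule T N × q ∉ N × r ∉ M)
  overlap-shape {M} {N} M-min M-mod N-min M⋈N with proj₁ N-min | overlap⁻ M⋈N
  ... | inj₂ ∁N-ntm | _ =
    ⊥-elim (∁-module-overlap-free N-min ∁N-ntm (proj₁ M-min) (overlap-sym M⋈N))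
  ... | inj₁ (N-mod , _) | p , q , r , p∈M , p∈N , q∈M , q∉N , r∈N , r∉M =
    p , q , r ,
    overlapping-modules-pair M-min M-mod N-mod p∈M p∈N q∈M q∉N r∈N r∉M ,
    overlapping-modules-pair N-min N-mod M-mod p∈N p∈M r∈N r∉M q∈M q∉N ,
    N-mod , q∉N , r∉M

  twins-sym : ∀ {x y} → Twins x y → Twins y x
  twins-sym {x} {y} = subst (IsModule T) (∪-comm ⁅ x ⁆ ⁅ y ⁆)

  ExternalTwin : Subset n → Set
  ExternalTwin M = ∃[ w ] ∃[ x ] ∃[ y ]
    (w ∉ M × x ∈ M × y ∈ M × A w x ≡ true × A x y ≡ true × Twins w x)

  externalTwin? : Decidable ExternalTwin
  externalTwin? M = any? λ w → any? λ x → any? λ y →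
    ¬? (w ∈? M) ×-dec (x ∈? M) ×-dec (y ∈? M) ×-dec
    (A w x ≟ᵇ true) ×-dec (A x y ≟ᵇ true) ×-dec isModule? (pair w x)

  overlap-arcs : ∀ {M p q r} → IsModule T M → Twins p r → p ∈ M → q ∈ M → r ∉ M →
                 q ∉ pair p r → ¬ ExternalTwin M → A q p ≡ true × A p r ≡ true
  overlap-arcs {M} {p} {q} {r} M-mod pr-twins p∈M q∈M r∉M q∉pr noTwin = q→p , p→r
    where
    r≢p : r ≢ p
    r≢p refl = r∉M p∈M
    q≢p : q ≢ p
    q≢p q≡p = q∉pr (subst (_∈ pair p r) (sym q≡p) (∈-pairˡ p r))
    qp≡pr : A q p ≡ A p r
    qp≡pr = begin
      A q p        ≡⟨ pr-twins p r q (∈-pairˡ p r) (∈-pairʳ p r) q∉pr ⟩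
      A q r        ≡⟨ arc-flip (λ { refl → q∉pr (∈-pairʳ p r) }) ⟩
      not (A r q)  ≡⟨ cong not (M-mod p q r p∈M q∈M r∉M) ⟨
      not (A r p)  ≡⟨ arc-flip (r≢p ∘′ sym) ⟨
      A p r        ∎
      where open ≡-Reasoning
    -- The other orientation r → p → q would make r an external twin of p.
    p→r : A p r ≡ true
    p→r with A r p in r→p?
    ... | false = arc-reverse r≢p r→p?
    ... | true = ⊥-elim (noTwin (r , p , q , r∉M , p∈M , q∈M , r→p? , p→q , twins-sym pr-twins))
      where
      p→q : A p q ≡ true
      p→q = arc-reverse q≢p (trans qp≡pr (arc-reverse′ r≢p r→p?))
    q→p : A q p ≡ true
    q→p = trans qp≡pr p→r

  pair-arc-target-unique : ∀ {p q p′ q′} → pair p q ≡ pair p′ q′ →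
                     A q p ≡ true → A q′ p′ ≡ true → p′ ≡ p
  pair-arc-target-unique {p} {q} {p′} {q′} pq≡p′q′ q→p q′→p′
    with ∈-pair⁻ (subst (p′ ∈_) (sym pq≡p′q′) (∈-pairˡ p′ q′))
  ... | inj₁ p′≡p = p′≡p
  ... | inj₂ refl with ∈-pair⁻ (subst (q′ ∈_) (sym pq≡p′q′) (∈-pairʳ p′ q′))
  ...   | inj₁ refl = ⊥-elim (arc-asym q→p q′→p′)
  ...   | inj₂ refl = ⊥-elim (arc-irrefl q′→p′)

  twin-out-neighbour-unique : ∀ {p r r′} → Twins p r → Twins p r′ →
                              A p r ≡ true → A p r′ ≡ true → r ≡ r′
  twin-out-neighbour-unique {p} {r} {r′} pr-twins pr′-twins p→r p→r′ with r ≟ᶠ r′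
  ... | yes r≡r′ = r≡r′
  ... | no r≢r′ = ⊥-elim (arc-asym p→r r→p)
    where
    r′↛r : A r′ r ≡ false
    r′↛r = trans (sym (pr-twins p r r′ (∈-pairˡ p r) (∈-pairʳ p r)
                   (∉-pair⁺ (λ { refl → arc-irrefl p→r′ }) (r≢r′ ∘′ sym))))
                 (arc-reverse′ (λ { refl → arc-irrefl p→r′ }) p→r′)
    r→p : A r p ≡ true
    r→p = trans (pr′-twins p r′ r (∈-pairˡ p r′) (∈-pairʳ p r′)
                  (∉-pair⁺ (λ { refl → arc-irrefl p→r }) r≢r′))
                (arc-reverse (r≢r′ ∘′ sym) r′↛r)

  module-atMostOneOverlap : ∀ {M} → MinCoModule T M → IsModule T M → ¬ ExternalTwin M →
                            AtMostOneOverlap T M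
  module-atMostOneOverlap {M} M-min M-mod noTwin N N′ N-min N′-min M⋈N M⋈N′
    with overlap-shape M-min M-mod N-min M⋈N | overlap-shape M-min M-mod N′-min M⋈N′
  ... | p , q , r , refl , refl , N-mod , q∉N , r∉M
      | p′ , q′ , r′ , pq≡p′q′ , refl , N′-mod , q′∉N′ , r′∉M
    with overlap-arcs M-mod N-mod (∈-pairˡ p q) (∈-pairʳ p q) r∉M q∉N noTwin
       | overlap-arcs (subst (IsModule T) pq≡p′q′ M-mod) N′-mod (∈-pairˡ p′ q′) (∈-pairʳ p′ q′)
                      (subst (r′ ∉_) pq≡p′q′ r′∉M) q′∉N′ (subst (¬_ ∘′ ExternalTwin) pq≡p′q′ noTwin)
  ... | q→p , p→r | q′→p′ , p′→r′ with pair-arc-target-unique pq≡p′q′ q→p q′→p′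
  ... | refl with twin-out-neighbour-unique N-mod N′-mod p→r p′→r′
  ... | refl = refl

  module-∪-twin : ∀ {C w x} → IsModule T C → w ∈ C → Twins w x → IsModule T (C ∪ ⁅ x ⁆)
  module-∪-twin {C} {w} {x} C-mod w∈C wx-twins u u′ v u∈ u′∈ v∉ =
    trans (asW u∈) (sym (asW u′∈))
    where
    v∉C : v ∉ C
    v∉C = v∉ ∘′ p⊆p∪q ⁅ x ⁆
    asW : ∀ {u} → u ∈ C ∪ ⁅ x ⁆ → A v u ≡ A v w
    asW {u} u∈ with ∈-∪-⁅⁆⁻ u∈
    ... | inj₁ u∈C = C-mod u w v u∈C w∈C v∉C
    ... | inj₂ refl = wx-twins u w v (∈-pairʳ w u) (∈-pairˡ w u)
                        (∉-pair⁺ (λ { refl → v∉C w∈C }) (λ { refl → v∉ (q⊆p∪q C ⁅ u ⁆ (x∈⁅x⁆ u)) }))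

  -- x sees all of C alike, so it is a source or a sink of T[C ∪ {x}].
  transitiveOn-∪-outsider : ∀ {C x} → IsModule T C → TransitiveOn T C → x ∉ C →
                            TransitiveOn T (C ∪ ⁅ x ⁆)
  transitiveOn-∪-outsider {C} {x} C-mod C-trans x∉C a b c a∈ b∈ c∈ a→b b→c
    with ∈-∪-⁅⁆⁻ a∈ | ∈-∪-⁅⁆⁻ b∈ | ∈-∪-⁅⁆⁻ c∈
  ... | inj₁ a∈C  | inj₁ b∈C  | inj₁ c∈C  = C-trans a b c a∈C b∈C c∈C a→b b→c
  ... | inj₁ a∈C  | inj₁ b∈C  | inj₂ refl = trans (module-outArc C-mod a∈C b∈C x∉C) b→c
  ... | inj₁ a∈C  | inj₂ refl | inj₁ c∈C  = ⊥-elim (arc-asym a→b (trans (C-mod a c b a∈C c∈C x∉C) b→c))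
  ... | inj₁ _    | inj₂ refl | inj₂ refl = a→b
  ... | inj₂ refl | inj₁ b∈C  | inj₁ c∈C  = trans (C-mod c b a c∈C b∈C x∉C) a→b
  ... | inj₂ refl | inj₁ _    | inj₂ refl = ⊥-elim (arc-asym a→b b→c)
  ... | inj₂ refl | inj₂ refl | _         = ⊥-elim (arc-irrefl a→b)

  twin-of-component : ∀ {C w x} → TransitiveComponent T C → w ∈ C → Twins w x → x ∈ C
  twin-of-component {C} {w} {x} (C-mod , C-trans , maximal) w∈C wx-twins with x ∈? C
  ... | yes x∈C = x∈C
  ... | no x∉C = subst (x ∈_) C∪x≡C (q⊆p∪q C ⁅ x ⁆ (x∈⁅x⁆ x))
    where
    C∪x≡C : C ∪ ⁅ x ⁆ ≡ C
    C∪x≡C = maximal (C ∪ ⁅ x ⁆) (module-∪-twin C-mod w∈C wx-twins)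
              (transitiveOn-∪-outsider C-mod C-trans x∉C) (p⊆p∪q ⁅ x ⁆)

  LowOverlapOutside : Subset n → Subset n → Set
  LowOverlapOutside C M = MinCoModule T M × Empty (M ∩ C) × AtMostOneOverlap T M

  ∁-module-atMostOneOverlap : ∀ {M} → MinCoModule T M → NontrivialModule T (∁ M) →
                              AtMostOneOverlap T M
  ∁-module-atMostOneOverlap M-min ∁M-ntm _ _ N-min _ M⋈N _ =
    ⊥-elim (∁-module-overlap-free M-min ∁M-ntm (proj₁ N-min) M⋈N)

  singleton-minimal : ∀ {w N} → CoModule T N → N ⊆ ⁅ w ⁆ → N ≡ ⁅ w ⁆
  singleton-minimal {w} N-co N⊆w with coModule-nonempty N-co
  ... | t , t∈N with x∈⁅y⁆⇒x≡y w (N⊆w t∈N)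
  ...   | refl = ⊆-antisym N⊆w (λ u∈w → subst (_∈ _) (sym (x∈⁅y⁆⇒x≡y t u∈w)) t∈N)

  singleton-overlap-free : ∀ {w N} → ¬ Overlap T ⁅ w ⁆ N
  singleton-overlap-free {w} w⋈N with overlap⁻ w⋈N
  ... | p , q , _ , p∈w , p∈N , q∈w , q∉N , _
    rewrite x∈⁅y⁆⇒x≡y w p∈w | x∈⁅y⁆⇒x≡y w q∈w = q∉N p∈N

  singleton-lowOverlapOutside : ∀ {C w} → CoModule T ⁅ w ⁆ → w ∉ C → LowOverlapOutside C ⁅ w ⁆
  singleton-lowOverlapOutside {C} {w} w-co w∉C =
    (w-co , λ _ N-co N⊆w → singleton-minimal N-co N⊆w) ,
    Empty-∩⁺ (λ { u∈w → subst (_∉ C) (sym (x∈⁅y⁆⇒x≡y w u∈w)) w∉C }) ,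
    λ _ _ _ _ w⋈N _ → ⊥-elim (singleton-overlap-free w⋈N)

  twin-pair-minCoModule : ∀ {M w x y} → MinCoModule T M → w ∉ M → x ∈ M → y ∈ M →
                          A x y ≡ true → Twins w x → ¬ CoModule T ⁅ w ⁆ → MinCoModule T (pair w x)
  twin-pair-minCoModule {M} {w} {x} {y} (_ , M-minimal) w∉M x∈M y∈M x→y wx-twins ¬w-co =
    inj₁ (wx-twins , nontrivial⁺ (∈-pairˡ w x) (∈-pairʳ w x) w≢x y∉wx) , minimal
    where
    w≢x : w ≢ x
    w≢x refl = w∉M x∈M
    y∉wx : y ∉ pair w x
    y∉wx = ∉-pair⁺ (λ { refl → w∉M y∈M }) (λ { refl → arc-irrefl x→y })
    minimal : ∀ N → CoModule T N → N ⊆ pair w x → N ≡ pair w x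
    minimal N N-co N⊆wx with ⊆-pair⁻ N⊆wx
    ... | inj₁ wx⊆N = ⊆-antisym N⊆wx wx⊆N
    ... | inj₂ (inj₁ N⊆w) = ⊥-elim (¬w-co (subst (CoModule T) (singleton-minimal N-co N⊆w) N-co))
    ... | inj₂ (inj₂ N⊆x) = ⊥-elim (y∉wx (N⊆wx y∈N))
      where
      y∈N : y ∈ N
      y∈N = subst (y ∈_) (sym (M-minimal N N-co N⊆M)) y∈M
        where
        N⊆M : N ⊆ M
        N⊆M u∈N = subst (_∈ M) (sym (x∈⁅y⁆⇒x≡y x (N⊆x u∈N))) x∈M

  twin-step : ∀ {C M w x y} → TransitiveComponent T C → MinCoModule T M → Empty (M ∩ C) →
              w ∉ M → x ∈ M → y ∈ M → A x y ≡ true → Twins w x →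
              ∃ (LowOverlapOutside C) ⊎ (MinCoModule T (pair w x) × Empty (pair w x ∩ C))
  twin-step {C} {M} {w} {x} C-comp M-min M-disj w∉M x∈M y∈M x→y wx-twins =
    Sum.map (λ w-co → ⁅ w ⁆ , singleton-lowOverlapOutside w-co w∉C)
            (λ ¬w-co → twin-pair-minCoModule M-min w∉M x∈M y∈M x→y wx-twins ¬w-co , wx-disj)
            (toSum (coModule? ⁅ w ⁆))
    where
    x∉C : x ∉ C
    x∉C = Empty-∩⁻ M-disj x∈M
    w∉C : w ∉ C
    w∉C w∈C = x∉C (twin-of-component C-comp w∈C wx-twins)
    wx-disj : Empty (pair w x ∩ C)
    wx-disj = Empty-∩⁺ (λ u∈wx → [ (λ { refl → w∉C }) , (λ { refl → x∉C }) ]′ (∈-pair⁻ u∈wx))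

  outNeighbours : Fin n → Subset n
  outNeighbours v = tabulate (A v)

  ∈-outNeighbours⁻ : ∀ {v u} → u ∈ outNeighbours v → A v u ≡ true
  ∈-outNeighbours⁻ {v} {u} u∈ = trans (sym (lookup∘tabulate (A v) u)) ([]=⇒lookup u∈)

  ∈-outNeighbours⁺ : ∀ {v u} → A v u ≡ true → u ∈ outNeighbours v
  ∈-outNeighbours⁺ {v} {u} v→u = lookup⇒[]= u (outNeighbours v) (trans (lookup∘tabulate (A v) u) v→u)

  twin-outNeighbours-⊂ : ∀ {w x} → Twins w x → A w x ≡ true → outNeighbours x ⊂ outNeighbours w
  twin-outNeighbours-⊂ {w} {x} wx-twins w→x =
    out⁺x⊆out⁺w , x , ∈-outNeighbours⁺ w→x , arc-irrefl ∘′ ∈-outNeighbours⁻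
    where
    out⁺x⊆out⁺w : outNeighbours x ⊆ outNeighbours w
    out⁺x⊆out⁺w {u} u∈ =
      ∈-outNeighbours⁺ (trans (module-outArc wx-twins (∈-pairˡ w x) (∈-pairʳ w x) u∉wx) x→u)
      where
      x→u : A x u ≡ true
      x→u = ∈-outNeighbours⁻ u∈
      u∉wx : u ∉ pair w x
      u∉wx = ∉-pair⁺ (λ { refl → arc-asym w→x x→u }) (λ { refl → arc-irrefl x→u })

  pair-arc-source : ∀ {x y a b} → A x y ≡ true → a ∈ pair x y → b ∈ pair x y → A a b ≡ true → a ≡ x
  pair-arc-source x→y a∈ b∈ a→b with ∈-pair⁻ a∈ | ∈-pair⁻ b∈
  ... | inj₁ a≡x | _         = a≡x
  ... | inj₂ refl | inj₁ refl = ⊥-elim (arc-asym x→y a→b)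
  ... | inj₂ refl | inj₂ refl = ⊥-elim (arc-irrefl a→b)

  -- The source x of the pair's arc is replaced by a twin w → x, which has more out-neighbours.
  twin-walk : ∀ {C} → TransitiveComponent T C → ∀ x → Acc (_⊃_ on outNeighbours) x → ∀ {y} →
              A x y ≡ true → Twins x y → MinCoModule T (pair x y) → Empty (pair x y ∩ C) →
              ∃ (LowOverlapOutside C)
  twin-walk C-comp x (acc rs) {y} x→y xy-twins xy-min xy-disj with externalTwin? (pair x y)
  ... | no noTwin = pair x y , xy-min , xy-disj , module-atMostOneOverlap xy-min xy-twins noTwin
  ... | yes (w , x′ , y′ , w∉ , x′∈ , y′∈ , w→x′ , x′→y′ , wx′-twins)
    with pair-arc-source x→y x′∈ y′∈ x′→y′
  ... | refl with twin-step C-comp xy-min xy-disj w∉ x′∈ y′∈ x′→y′ wx′-twins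
  ...   | inj₁ found = found
  ...   | inj₂ (wx-min , wx-disj) =
    twin-walk C-comp w (rs (twin-outNeighbours-⊂ wx′-twins w→x′)) w→x′ wx′-twins wx-min wx-disj

  minCoModule-lowOverlapOutside : ∀ {C M} → TransitiveComponent T C → MinCoModule T M →
                                  Empty (M ∩ C) → ∃ (LowOverlapOutside C)
  minCoModule-lowOverlapOutside {M = M} C-comp M-min M-disj with proj₁ M-min | externalTwin? M
  ... | inj₂ ∁M-ntm | _ = M , M-min , M-disj , ∁-module-atMostOneOverlap M-min ∁M-ntm
  ... | inj₁ (M-mod , _) | no noTwin = M , M-min , M-disj , module-atMostOneOverlap M-min M-mod noTwin
  ... | inj₁ _ | yes (w , x , y , w∉ , x∈ , y∈ , w→x , x→y , wx-twins)
    with twin-step C-comp M-min M-disj w∉ x∈ y∈ x→y wx-twins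
  ...   | inj₁ found = found
  ...   | inj₂ (wx-min , wx-disj) =
    twin-walk C-comp w (On.wellFounded outNeighbours ⊃-wellFounded w) w→x wx-twins wx-min wx-disj

corollary5 : (n : ℕ) (T : Tournament n) (C : Subset n) →
             TransitiveComponent T C → NontrivialModule T C →
             ∃ λ M → MinCoModule T M × Empty (M ∩ C) × AtMostOneOverlap T M
corollary5 n T C C-comp C-ntm with minimal-⊆ (coModule? T) (∁-coModule T C-ntm)
... | M , M-min , M⊆∁C =
  minCoModule-lowOverlapOutside T C-comp M-min (Empty-∩⁺ (λ x∈M → x∈∁p⇒x∉p (M⊆∁C x∈M)))
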